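{- Let $p^G\colon G\to\mathsf{fc}(\Sigma)$ and $p^H\colon H\to\mathsf{fc}(\Sigma)$ be graphs with testing and $R\subseteq\mathrm{ob}(G)\times\mathrm{ob}(H)$ a fair relation. If $x\,R\,y$ and $x'\,R\,y'$, then $x\simeq_G x'$ (fair testing equivalence in $G$) if and only if $y\simeq_H y'$.
   Context: All graphs are reflexive (each vertex has an identity edge, preserved by morphisms). Convention: we write $x\xleftarrow{a}y$ if there is an edge $e\colon y\to x$ with $p(e)=a$, and $x\leftarrow y$ if $a$ is the identity. $\Sigma$ is the reflexive graph with one vertex and endo-edges $\tau$ (the identity) and $\heartsuit$; $\mathsf{fc}(\Sigma)$ is its free category viewed as a reflexive graph: one vertex, edges $\heartsuit^k$ for $k\ge0$, $\heartsuit^0$ the identity. Strong bisimilarity $\sim_{\mathsf{fc}(\Sigma)}$ between vertices of graphs over $\mathsf{fc}(\Sigma)$ is the largest relation $S$ such that if $x\,S\,y$ and $x\xleftarrow{a}x'$ then $y\xleftarrow{a}y'$ with $x'\,S\,y'$, and symmetrically. A graph with testing is a graph $G$ with $p\colon G\to\mathsf{fc}(\Sigma)$ and a relation $R_G\colon(\mathrm{ob}(G))^2\to\mathrm{ob}(G)$, written $z\in(x\mid_G y)$, whose domain $\{(x,y)\mid\exists z.\,z\in(x\mid_G y)\}$, denoted $\mathrel{\mathrm{coh}_G}$, is an equivalence relation and such that $z,z'\in(x\mid_G y)$ implies $z\sim_{\mathsf{fc}(\Sigma)}z'$. One fixes a global choice of an element of $(x\mid_G y)$ for each $(x,y)$ in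 the domain, and $(x\mid_G y)$ denotes this chosen element. $\bot^G$ is the set of vertices $x$ of $G$ such that for every $x\leftarrow y$ (an edge over the identity) there exists $y\xleftarrow{\heartsuit}z$ (an edge over $\heartsuit=\heartsuit^1$). Two vertices $x,y$ are fair testing equivalent, $x\simeq_G y$, iff $x\mathrel{\mathrm{coh}_G}y$ and for all $z$ with $z\mathrel{\mathrm{coh}_G}x$, $(x\mid_G z)\in\bot^G$ iff $(y\mid_G z)\in\bot^G$. A relation $R\subseteq\mathrm{ob}(G)\times\mathrm{ob}(H)$ is fair iff: (i) $x\,R\,y$ and $x'\,R\,y'$ imply ($x\mathrel{\mathrm{coh}_G}x'\iff y\mathrel{\mathrm{coh}_H}y'$); (ii) $R$ is total and surjective; (iii) $x\,R\,y$ implies $x\sim_{\mathsf{fc}(\Sigma)}y$; (iv) if $x\,R\,y$, $x'\,R\,y'$ and $x\mathrel{\mathrm{coh}_G}x'$, then there exist $u\in(x\mid_G x')$ and $v\in(y\mid_H y')$ with $u\,R\,v$. -}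

module Defs where

open import Level using (Level; _⊔_) renaming (suc to lsuc)
open import Data.Nat using (ℕ; zero; suc)
open import Data.Product using (Σ; ∃; ∃-syntax; _×_; _,_)
open import Relation.Binary.PropositionalEquality using (_≡_)
open import Relation.Binary.Structures using (IsEquivalence)
open import Function.Bundles using (_⇔_)

-- A reflexive graph G equipped with a morphism p : G → fc(Σ).
-- fc(Σ) has one vertex and edges ♡^k (k : ℕ), ♡^0 the identity;
-- so p is just a labelling of edges by ℕ, sending identity edges to 0.
record GraphOver : Set₁ where
  field
    V     : Set
    E     : V → V → Set
    lab   : ∀ {s t} → E s t → ℕ
    idE   : ∀ x → E x x
    lab-id : ∀ x → lab (idE x) ≡ 0

  _⟵[_]_ : V → ℕ → V → Set
  x ⟵[ a ] y = Σ (E y x) λ e → lab e ≡ a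


IsBisim : (G H : GraphOver) → (GraphOver.V G → GraphOver.V H → Set) → Set
IsBisim G H S =
  (∀ {x y} → S x y → ∀ a x' → x ⟵G[ a ] x' → ∃[ y' ] (y ⟵H[ a ] y' × S x' y'))
  × (∀ {x y} → S x y → ∀ a y' → y ⟵H[ a ] y' → ∃[ x' ] (x ⟵G[ a ] x' × S x' y'))
  where
    open GraphOver G renaming (_⟵[_]_ to _⟵G[_]_)
    open GraphOver H renaming (_⟵[_]_ to _⟵H[_]_)

-- Strong bisimilarity ∼_{fc(Σ)}: the largest bisimulation, i.e. the
-- union of all bisimulations.
Bisimilar : (G H : GraphOver) → GraphOver.V G → GraphOver.V H → Set₁
Bisimilar G H x y = Σ (GraphOver.V G → GraphOver.V H → Set) λ S → IsBisim G H S × S x y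

record TestGraph : Set₁ where
  field
    graph : GraphOver
  open GraphOver graph public
  field
    Par   : V → V → V → Set      -- Par x y z  means  z ∈ (x | y)
  Coh : V → V → Set
  Coh x y = ∃[ z ] Par x y z
  field
    coh-equiv : IsEquivalence Coh
    par-bisim : ∀ {x y z z'} → Par x y z → Par x y z' → Bisimilar graph graph z z'
    -- global choice of an element of (x | y) for (x,y) in the domain
    choose    : ∀ {x y} → Coh x y → V
    choose∈   : ∀ {x y} (c : Coh x y) → Par x y (choose c)

  Bot : V → Set
  Bot x = ∀ y → x ⟵[ 0 ] y → ∃[ z ] (y ⟵[ 1 ] z)

  -- fair testing equivalence x ≃_G y
  -- (for z coh x, the chosen elements (x|z), (y|z); quantified over the
  -- witnesses of coherence, on which the chosen element may depend)
  _≃_ : V → V → Set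
  x ≃ y = Coh x y × (∀ z → Coh z x → (cx : Coh x z) (cy : Coh y z) →
                       (Bot (choose cx) ⇔ Bot (choose cy)))

record IsFair (G H : TestGraph) (R : TestGraph.V G → TestGraph.V H → Set) : Set₁ where
  private
    module G = TestGraph G
    module H = TestGraph H
  field
    coh-iff   : ∀ {x y x' y'} → R x y → R x' y' → (G.Coh x x' ⇔ H.Coh y y')
    total     : ∀ x → ∃[ y ] R x y
    surjective : ∀ y → ∃[ x ] R x y
    bisim     : ∀ {x y} → R x y → Bisimilar G.graph H.graph x y
    par-rel   : ∀ {x y x' y'} → R x y → R x' y' → G.Coh x x' →
                ∃[ u ] ∃[ v ] (G.Par x x' u × H.Par y y' v × R u v)

module Submission where

-- Whether a vertex lies in ⊥ ("every silent derivative can still perform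
-- ♡") is a property of its strong bisimilarity class (bot-bisimilar).  In a
-- graph with testing all elements of (x | z) are bisimilar, so ⊥-membership
-- of the chosen element does not depend on the choice (bot-par).  A fair
-- relation R relates bisimilar vertices and relates some element of (x | z)
-- to some element of (y | w) whenever x R y and z R w; hence the outcome of
-- testing x against z equals that of testing y against w (bot-transfer).
-- Given x R y and x' R y', every test w of H is related to a test z of G
-- (surjectivity), and the test outcomes for y, y' against w equal those
-- for x, x' against z; this gives one direction (≃-transfer).  The converse
-- is the same argument for the converse relation, which is again fair
-- (fair-converse).

open import Defs
open import Level using (0ℓ)
open import Data.Product using (∃-syntax; _×_; _,_)
open import Function.Bundles using (_⇔_; mk⇔; Equivalence)
open import Function.Properties.Equivalence using (⇔-setoid) renaming (sym to ⇔-sym)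
import Relation.Binary.Reasoning.Setoid as SetoidReasoning

open SetoidReasoning (⇔-setoid 0ℓ)
  using (begin_; step-≈-⟩; step-≈-⟨; _∎)

open Equivalence using (to; from)

Bot : (G : GraphOver) → GraphOver.V G → Set
Bot G x = ∀ y → x ⟵[ 0 ] y → ∃[ z ] (y ⟵[ 1 ] z)
  where open GraphOver G

bisimilar-sym : (G H : GraphOver) → ∀ {x y} → Bisimilar G H x y → Bisimilar H G y x
bisimilar-sym G H (S , (forth , back) , xSy) =
  (λ b a → S a b) , ((λ s → back s) , (λ s → forth s)) , xSy

-- ⊥ is closed under bisimilarity (one direction): a silent step of y is
-- matched by a silent step of x, whose ♡-step is matched back from y's side.
bot-bisimilar→ : (G H : GraphOver) → ∀ {x y} → Bisimilar G H x y → Bot G x → Bot H y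
bot-bisimilar→ G H (S , (forth , back) , xSy) botx y' y⟵y'
  with back xSy 0 y' y⟵y'
... | x' , x⟵x' , x'Sy' with botx x' x⟵x'
... | z , x'⟵z with forth x'Sy' 1 z x'⟵z
... | z' , y'⟵z' , _ = z' , y'⟵z'

bot-bisimilar : (G H : GraphOver) → ∀ {x y} → Bisimilar G H x y → (Bot G x ⇔ Bot H y)
bot-bisimilar G H x∼y =
  mk⇔ (bot-bisimilar→ G H x∼y) (bot-bisimilar→ H G (bisimilar-sym G H x∼y))

bot-par : (G : TestGraph) → let open TestGraph G hiding (Bot) in
  ∀ {x z u} (c : Coh x z) → Par x z u → (Bot graph (choose c) ⇔ Bot graph u)
bot-par G c u∈ = bot-bisimilar graph graph (par-bisim (choose∈ c) u∈)
  where open TestGraph G hiding (Bot)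

fair-converse : (G H : TestGraph) (R : TestGraph.V G → TestGraph.V H → Set) →
  IsFair G H R → IsFair H G (λ y x → R x y)
fair-converse G H R fair = record
  { coh-iff    = λ r r' → ⇔-sym (coh-iff r r')
  ; total      = surjective
  ; surjective = total
  ; bisim      = λ r → bisimilar-sym (TestGraph.graph G) (TestGraph.graph H) (bisim r)
  ; par-rel    = λ r r' c → converse-par (par-rel r r' (from (coh-iff r r') c))
  }
  where
    open IsFair fair
    converse-par : ∀ {A B : Set} {P : A → Set} {Q : B → Set} {S : A → B → Set} →
      ∃[ u ] ∃[ v ] (P u × Q v × S u v) → ∃[ v ] ∃[ u ] (Q v × P u × S u v)
    converse-par (u , v , pu , qv , uSv) = v , u , qv , pu , uSv

bot-transfer : (G H : TestGraph) (R : TestGraph.V G → TestGraph.V H → Set) →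
  IsFair G H R → ∀ {x y z w} → R x y → R z w →
  (cx : TestGraph.Coh G x z) (cy : TestGraph.Coh H y w) →
  (Bot (TestGraph.graph G) (TestGraph.choose G cx) ⇔
   Bot (TestGraph.graph H) (TestGraph.choose H cy))
bot-transfer G H R fair r rz cx cy with IsFair.par-rel fair r rz cx
... | u , v , u∈ , v∈ , uRv = begin
  Bot G.graph (G.choose cx)  ≈⟨ bot-par G cx u∈ ⟩
  Bot G.graph u              ≈⟨ bot-bisimilar G.graph H.graph (IsFair.bisim fair uRv) ⟩
  Bot H.graph v              ≈⟨ bot-par H cy v∈ ⟨
  Bot H.graph (H.choose cy)  ∎
  where
    module G = TestGraph G
    module H = TestGraph H

-- Fair relations preserve fair testing equivalence: every test w of H is
-- simulated by a related test z of G.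
≃-transfer : (G H : TestGraph) (R : TestGraph.V G → TestGraph.V H → Set) →
  IsFair G H R → ∀ {x x' y y'} → R x y → R x' y' →
  TestGraph._≃_ G x x' → TestGraph._≃_ H y y'
≃-transfer G H R fair r r' (cxx' , sameOutcomes) =
  to (coh-iff r r') cxx' , λ w cwy cy cy' →
    let (z , rz) = surjective w
        cxz  = from (coh-iff r rz) cy
        cx'z = from (coh-iff r' rz) cy'
    in begin
      Bot H.graph (H.choose cy)    ≈⟨ bot-transfer G H R fair r rz cxz cy ⟨
      Bot G.graph (G.choose cxz)   ≈⟨ sameOutcomes z (from (coh-iff rz r) cwy) cxz cx'z ⟩
      Bot G.graph (G.choose cx'z)  ≈⟨ bot-transfer G H R fair r' rz cx'z cy' ⟩
      Bot H.graph (H.choose cy')   ∎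
  where
    open IsFair fair
    module G = TestGraph G
    module H = TestGraph H

lemma2p22 : (G H : TestGraph) (R : TestGraph.V G → TestGraph.V H → Set) →
    IsFair G H R →
    ∀ {x x' y y'} → R x y → R x' y' →
    (TestGraph._≃_ G x x' ⇔ TestGraph._≃_ H y y')
lemma2p22 G H R fair r r' =
  mk⇔ (≃-transfer G H R fair r r')
      (≃-transfer H G (λ y x → R x y) (fair-converse G H R fair) r r')
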